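{- Let $\mathcal{M}=\langle S,R,V\rangle$ be a Kripke model. Then its qf-variation $qf(\mathcal{M})$ is a quasi-filter model.
   Context: The qf-variation of a Kripke model $\langle S,R,V\rangle$ is the neighborhood model $\langle S,qfN,V\rangle$ with $qfN(s)=\{X\subseteq S:\text{for all }t,u\in S\text{, if }sRt\text{ and }sRu\text{ then }(t\in X\text{ iff }u\in X)\}$. A neighborhood model $\langle S,N,V\rangle$ is a quasi-filter model if for every $s\in S$: $(n)$ $S\in N(s)$; $(i)$ $X,Y\in N(s)$ implies $X\cap Y\in N(s)$; $(c)$ $X\in N(s)$ implies $S\setminus X\in N(s)$; $(ws)$ for all $X,Y,Z\subseteq S$, $X\in N(s)$ implies $X\cup Y\in N(s)$ or $(S\setminus X)\cup Z\in N(s)$. -}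

module Defs where

open import Level using (Level; 0ℓ) renaming (suc to lsuc)
open import Data.Product using (_×_)
open import Data.Sum using (_⊎_)
open import Relation.Nullary using (¬_)
open import Relation.Unary using (Pred; _∈_; _∩_; _∪_; ∁; U)

-- Subsets of a carrier S are predicates  Pred S 0ℓ  (classically: arbitrary subsets).
-- Propositional variables range over an arbitrary type Prop.

record KripkeModel (Prop : Set) : Set₁ where
  field
    S : Set
    R : S → S → Set
    V : Prop → Pred S 0ℓ

record NeighborhoodModel (Prop : Set) : Set₂ where
  field
    S : Set
    N : S → Pred (Pred S 0ℓ) 0ℓ
    V : Prop → Pred S 0ℓ

qf : {Prop : Set} → KripkeModel Prop → NeighborhoodModel Prop
qf M = record
  { S = S
  ; N = λ s X → ∀ t u → R s t → R s u → ((t ∈ X → u ∈ X) × (u ∈ X → t ∈ X))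
  ; V = V
  }
  where open KripkeModel M

record IsQuasiFilter {Prop : Set} (𝔑 : NeighborhoodModel Prop) : Set₁ where
  open NeighborhoodModel 𝔑
  field
    n  : ∀ s → U ∈ N s
    i  : ∀ s (X Y : Pred S 0ℓ) → X ∈ N s → Y ∈ N s → (X ∩ Y) ∈ N s
    c  : ∀ s (X : Pred S 0ℓ) → X ∈ N s → ∁ X ∈ N s
    ws : ∀ s (X Y Z : Pred S 0ℓ) → X ∈ N s → ((X ∪ Y) ∈ N s) ⊎ ((∁ X ∪ Z) ∈ N s)

-- qfN(s) consists of the sets on which membership is constant over the successors R[s] of s. For (ws), excluded middle lets
-- R[s] lie entirely inside X or entirely inside its complement, and in either case enlarging
-- that set by a union keeps R[s] inside it, hence keeps it in qfN(s).
module Submission where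

open import Defs
open import Level using (0ℓ)
open import Axiom.ExcludedMiddle using (ExcludedMiddle)
open import Data.Product using (_×_; _,_; proj₁; proj₂)
open import Data.Sum using (_⊎_; inj₁; inj₂)
open import Relation.Nullary using (yes; no)
open import Relation.Unary using (Pred; _∈_; _∩_; _∪_; ∁; U; _⊆_)

module _ {S : Set} where

  ConstantOn : Pred S 0ℓ → Pred (Pred S 0ℓ) 0ℓ
  ConstantOn A X = ∀ t u → t ∈ A → u ∈ A → (t ∈ X → u ∈ X) × (u ∈ X → t ∈ X)

  U-constantOn : ∀ A → ConstantOn A U
  U-constantOn A t u _ _ = (λ _ → _) , (λ _ → _)

  ∩-constantOn : ∀ A X Y → ConstantOn A X → ConstantOn A Y → ConstantOn A (X ∩ Y)
  ∩-constantOn A X Y constX constY t u t∈A u∈A =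
      (λ (t∈X , t∈Y) → proj₁ X[t,u] t∈X , proj₁ Y[t,u] t∈Y)
    , (λ (u∈X , u∈Y) → proj₂ X[t,u] u∈X , proj₂ Y[t,u] u∈Y)
    where
    X[t,u] = constX t u t∈A u∈A
    Y[t,u] = constY t u t∈A u∈A

  ∁-constantOn : ∀ A X → ConstantOn A X → ConstantOn A (∁ X)
  ∁-constantOn A X constX t u t∈A u∈A =
      (λ t∉X u∈X → t∉X (proj₂ (constX t u t∈A u∈A) u∈X))
    , (λ u∉X t∈X → u∉X (proj₁ (constX t u t∈A u∈A) t∈X))

  ⊆⇒constantOn : ∀ A X → A ⊆ X → ConstantOn A X
  ⊆⇒constantOn A X A⊆X t u t∈A u∈A = (λ _ → A⊆X u∈A) , (λ _ → A⊆X t∈A)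

  constantOn⇒⊆⊎⊆∁ : ExcludedMiddle 0ℓ → ∀ A X → ConstantOn A X → A ⊆ X ⊎ A ⊆ ∁ X
  constantOn⇒⊆⊎⊆∁ em A X constX with em {A ⊆ X}
  ... | yes A⊆X = inj₁ A⊆X
  ... | no  A⊈X = inj₂ λ t∈A t∈X →
    A⊈X λ u∈A → proj₁ (constX _ _ t∈A u∈A) t∈X

  constantOn-∪ : ExcludedMiddle 0ℓ → ∀ A X Y Z → ConstantOn A X →
                 ConstantOn A (X ∪ Y) ⊎ ConstantOn A (∁ X ∪ Z)
  constantOn-∪ em A X Y Z constX with constantOn⇒⊆⊎⊆∁ em A X constX
  ... | inj₁ A⊆X  = inj₁ (⊆⇒constantOn A (X ∪ Y) (λ t∈A → inj₁ (A⊆X t∈A)))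
  ... | inj₂ A⊆∁X = inj₂ (⊆⇒constantOn A (∁ X ∪ Z) (λ t∈A → inj₁ (A⊆∁X t∈A)))

proposition11 : ExcludedMiddle 0ℓ → {Prop : Set} (M : KripkeModel Prop) → IsQuasiFilter (qf M)
proposition11 em M = record
  { n  = λ s → U-constantOn (R s)
  ; i  = λ s → ∩-constantOn (R s)
  ; c  = λ s → ∁-constantOn (R s)
  ; ws = λ s → constantOn-∪ em (R s)
  }
  where open KripkeModel M
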